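{- (i) Let $m\in\mathbb{N}=\{0,1,2,\ldots\}$ and $n\in\mathbb{Z}^+$. Then $$2\binom{m+n}{n}\ \Big|\ \binom{2n}{n}\binom{2m+2n}{2n},$$ and the quotient $\binom{2n}{n}\binom{2m+2n}{2n}\big/\big(2\binom{m+n}{n}\big)$ is odd if and only if $n$ is a power of two. Moreover, when $n>1$, $$8\binom{m+n}{n}\ \Big|\ \binom{2n}{n}\binom{2m+2n}{2n-1},$$ and the quotient $\binom{2n}{n}\binom{2m+2n}{2n-1}\big/\big(8\binom{m+n}{n}\big)$ is odd if and only if $n-1$ is a power of two. (ii) Let $k,n\in\mathbb{Z}^+$. Then $$2\binom{kn}{n}\ \Big|\ \binom{2n}{n}C_{2n}^{(k-1)},$$ and the quotient $\binom{2n}{n}C_{2n}^{(k-1)}\big/\big(2\binom{kn}{n}\big)$ is odd if and only if $n$ is a power of two.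
   Context: For $h,m\in\mathbb{N}$, the generalized Catalan number of order $h$ is $C_m^{(h)}=\frac{1}{hm+1}\binom{(h+1)m}{m}=\binom{(h+1)m}{m}-h\binom{(h+1)m}{m-1}$, an integer. "Power of two" means $2^a$ for some $a\in\mathbb{N}$ (so $1$ counts). -}

module Defs where

open import Data.Nat using (ℕ; zero; suc; _+_; _*_; _∸_; _^_)
open import Data.Nat.Divisibility using (_∣_)
open import Data.Nat.Combinatorics using (_C_)
open import Data.Product using (∃-syntax)
open import Relation.Binary.PropositionalEquality using (_≡_)
open import Relation.Nullary using (¬_)

IsPowerOfTwo : ℕ → Set
IsPowerOfTwo n = ∃[ a ] n ≡ 2 ^ a

Odd : ℕ → Set
Odd q = ¬ (2 ∣ q)

-- generalized Catalan number of order h: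
-- C_m^(h) = binom((h+1)m, m) - h * binom((h+1)m, m-1)   (an integer, ≥ 0)
-- For m = 0 the second term is h * binom(0, -1) = 0; handled separately
-- since truncated subtraction m ∸ 1 would give binom(0,0).
catalan : ℕ → ℕ → ℕ
catalan h zero = 1
catalan h (suc m) = ((suc h * suc m) C suc m) ∸ (h * ((suc h * suc m) C m))

module Submission where

-- Proof strategy.  Everything reduces to 2-adic valuations.
--
-- (1) Legendre's formula for p = 2, in the multiplicative form
--       n! · 2^s = 2^n · (odd number),    s = s₂(n) the binary digit sum,
--     with s = 0 iff n = 0 and s = 1 iff n is a power of two; it is proved
--     by induction along the binary expansion of n, using (2k)! = 2^k·k!·(2k−1)!!.
-- (2) The halving criterion: if H · n! · X = 2^n · Y with X, Y odd and n > 0,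
--     then v₂(H) = s₂(n) ≥ 1, so H is even and H/2 is odd iff n is a power of two.
-- (3) The integer G(m,n) = 2^n (2m+1)(2m+3)⋯(2m+2n−1) / n!, defined by a Pascal-type
--     recursion, satisfies the hypothesis of (2), and
--       binom(2n,n) · binom(2m+2n,2n) = G(m,n) · binom(m+n,n),
--       n · G(m,n) = 2(2m+1) · G(m+1,n−1).
-- Part (i) follows by applying (2) to G(m,n), resp. to G(m+1,n−1) after the
-- absorption identity binom(2m+2n,2n−1)·(2m+1) = binom(2m+2n,2n)·2n.  For part (ii),
-- write k = h+1 and m = hn: then binom(2n,n)·C^{(h)}_{2n}·(2m+1) = G(m,n)·binom(m+n,n),
-- and since 2m+1 is coprime to n, (2m+1) ∣ G(m,n); (2) applies to G(m,n)/(2m+1).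

open import Defs
open import Data.Nat using (ℕ; zero; suc; _+_; _*_; _∸_; _^_; _>_; _<_; _≤_; _!; s≤s; z<s; NonZero; ≢-nonZero; ≢-nonZero⁻¹)
open import Data.Nat.Properties
open import Data.Nat.Divisibility using (_∣_; divides; m∣m*n; ∣m⇒∣m*n; ∣n⇒∣m*n; *-monoˡ-∣; ∣m+n∣m⇒∣n; ∣1⇒≡1)
open import Data.Nat.DivMod using (_/_; m/n*n≡m)
open import Data.Nat.Combinatorics using (_C_; k![n∸k]!∣n!; nCk≡n!/k![n-k]!)
open import Data.Nat.Coprimality using (Coprime; coprime-divisor)
open import Data.Nat.Primality using (euclidsLemma; prime[2])
open import Data.Nat.Induction using (<-rec)
open import Algebra.Properties.CommutativeSemigroup *-commutativeSemigroup using (x∙yz≈y∙xz)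
open import Data.Nat.Tactic.RingSolver using (solve-∀)
open import Data.Product using (_×_; _,_; ∃-syntax)
open import Data.Sum using (_⊎_; inj₁; inj₂; [_,_]′)
open import Function.Bundles using (_⇔_; mk⇔; Equivalence)
open import Function.Construct.Composition using (_⇔-∘_)
open import Function.Construct.Symmetry using (⇔-sym)
open import Relation.Binary.PropositionalEquality
open import Relation.Nullary using (¬_; contradiction)

open ≡-Reasoning

odd-2k+1 : ∀ k → Odd (suc (2 * k))
odd-2k+1 k (divides q 2k+1≡q*2) = even≢odd q k (trans (*-comm 2 q) (sym 2k+1≡q*2))

odd-* : ∀ {a b} → Odd a → Odd b → Odd (a * b)
odd-* {a} {b} odd-a odd-b 2∣ab = [ odd-a , odd-b ]′ (euclidsLemma a b prime[2] 2∣ab)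

halve : ∀ n → ∃[ k ] (n ≡ 2 * k ⊎ n ≡ suc (2 * k))
halve zero = 0 , inj₁ refl
halve (suc n) with halve n
... | k , inj₁ n≡2k   = k , inj₂ (cong suc n≡2k)
... | k , inj₂ n≡2k+1 = suc k , inj₁ (trans (cong suc n≡2k+1) (sym (*-suc 2 k)))

binary-induction : (P : ℕ → Set) → P 0 → (∀ k → P k → P (2 * k)) → (∀ k → P k → P (suc (2 * k)))
                 → ∀ n → P n
binary-induction P base double double+1 = <-rec P step
  where
  step : ∀ n → (∀ {m} → m < n → P m) → P n
  step zero _ = base
  step (suc n) rec with halve (suc n)
  ... | suc k , inj₁ eq = subst P (sym eq) (double (suc k) (rec (subst (suc k <_) (sym eq) (m<m+n (suc k) z<s))))
  ... | k , inj₂ eq = subst P (sym eq) (double+1 k (rec (subst (k <_) (sym eq) (s≤s (m≤m+n k (k + 0))))))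

¬pow2-0 : ¬ IsPowerOfTwo 0
¬pow2-0 (a , 0≡2^a) = <⇒≢ (m^n>0 2 a) 0≡2^a

pow2-double : ∀ k → IsPowerOfTwo (2 * k) ⇔ IsPowerOfTwo k
pow2-double k = mk⇔ halved (λ (a , k≡2^a) → suc a , cong (2 *_) k≡2^a)
  where
  halved : IsPowerOfTwo (2 * k) → IsPowerOfTwo k
  halved (zero , 2k≡1)       = contradiction 2k≡1 (even≢odd k 0)
  halved (suc a , 2k≡2·2^a) = a , *-cancelˡ-≡ k (2 ^ a) 2 2k≡2·2^a

pow2-odd : ∀ k → IsPowerOfTwo (suc (2 * k)) ⇔ k ≡ 0
pow2-odd k = mk⇔ is-one (λ { refl → 0 , refl })
  where
  is-one : IsPowerOfTwo (suc (2 * k)) → k ≡ 0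
  is-one (zero , 2k+1≡1)   = *-cancelˡ-≡ k 0 2 (suc-injective 2k+1≡1)
  is-one (suc a , 2k+1≡2^a) = contradiction (sym 2k+1≡2^a) (even≢odd (2 ^ a) k)

even-cofactor : ∀ {x o o'} s → x * o ≡ 2 ^ suc s * o' → Odd o → 2 ∣ x
even-cofactor {x} {o} {o'} s xo≡ odd-o =
  [ (λ 2∣x → 2∣x) , (λ 2∣o → contradiction 2∣o odd-o) ]′
    (euclidsLemma x o prime[2] (subst (2 ∣_) (sym xo≡) (∣m⇒∣m*n o' (m∣m*n (2 ^ s)))))

odd⇔exponent≡0 : ∀ {x o o'} s → x * o ≡ 2 ^ s * o' → Odd o → Odd o' → (Odd x ⇔ s ≡ 0)
odd⇔exponent≡0 {o = o} {o'} zero xo≡ _ odd-o' =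
  mk⇔ (λ _ → refl) (λ _ 2∣x → odd-o' (subst (2 ∣_) (trans xo≡ (*-identityˡ o')) (∣m⇒∣m*n o 2∣x)))
odd⇔exponent≡0 (suc s) xo≡ odd-o _ =
  mk⇔ (λ odd-x → contradiction (even-cofactor s xo≡ odd-o) odd-x) (λ ())

-- "d divides X, and X/d is odd exactly when P": the shape of every claim of the theorem.
OddQuotient : ℕ → ℕ → Set → Set
OddQuotient d X P = (d ∣ X) × (∀ q → d * q ≡ X → (Odd q ⇔ P))

oddQuotient-⇔ : ∀ {d X P Q} → P ⇔ Q → OddQuotient d X P → OddQuotient d X Q
oddQuotient-⇔ P⇔Q (d∣X , odd⇔P) = d∣X , λ q dq≡X → P⇔Q ⇔-∘ odd⇔P q dq≡X

oddQuotient-scale : ∀ {d X P} K .{{_ : NonZero K}} → OddQuotient d X P → OddQuotient (d * K) (X * K) P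
oddQuotient-scale {d} {X} K (d∣X , odd⇔P) = *-monoˡ-∣ K d∣X , λ q dKq≡XK →
    odd⇔P q (*-cancelʳ-≡ (d * q) X K (trans (swap d q K) dKq≡XK))
  where
  swap : ∀ a b c → a * b * c ≡ a * c * b
  swap = solve-∀

halving-by-exponent : ∀ {x o o'} s → x * o ≡ 2 ^ suc s * o' → Odd o → Odd o'
                    → OddQuotient 2 x (s ≡ 0)
halving-by-exponent {x} {o} {o'} s xo≡ odd-o odd-o' =
  even-cofactor s xo≡ odd-o , λ q 2q≡x → odd⇔exponent≡0 s (halved q 2q≡x) odd-o odd-o'
  where
  halved : ∀ q → 2 * q ≡ x → q * o ≡ 2 ^ s * o'
  halved q refl = *-cancelˡ-≡ (q * o) (2 ^ s * o') 2 (begin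
    2 * (q * o)     ≡⟨ sym (*-assoc 2 q o) ⟩
    2 * q * o       ≡⟨ xo≡ ⟩
    2 * 2 ^ s * o'  ≡⟨ *-assoc 2 (2 ^ s) o' ⟩
    2 * (2 ^ s * o') ∎)

oddFactorial : ℕ → ℕ
oddFactorial zero    = 1
oddFactorial (suc k) = oddFactorial k * suc (2 * k)

oddFactorial-odd : ∀ k → Odd (oddFactorial k)
oddFactorial-odd zero    = odd-2k+1 0
oddFactorial-odd (suc k) = odd-* (oddFactorial-odd k) (odd-2k+1 k)

double-factorial : ∀ k → (2 * k) ! ≡ 2 ^ k * k ! * oddFactorial k
double-factorial zero    = refl
double-factorial (suc k) = begin
    (2 * suc k) !                                           ≡⟨ cong _! (*-suc 2 k) ⟩
    (2 + 2 * k) * ((1 + 2 * k) * (2 * k) !)                 ≡⟨ cong (λ f → (2 + 2 * k) * ((1 + 2 * k) * f)) (double-factorial k) ⟩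
    (2 + 2 * k) * ((1 + 2 * k) * (2 ^ k * k ! * oddFactorial k)) ≡⟨ regroup k (2 ^ k) (k !) (oddFactorial k) ⟩
    2 ^ suc k * suc k ! * oddFactorial (suc k)              ∎
  where
  regroup : ∀ k p f d → (2 + 2 * k) * ((1 + 2 * k) * (p * f * d)) ≡ 2 * p * ((1 + k) * f) * (d * (1 + 2 * k))
  regroup = solve-∀

2^[2k] : ∀ k → 2 ^ (2 * k) ≡ 2 ^ k * 2 ^ k
2^[2k] k = trans (cong (2 ^_) (cong (k +_) (+-identityʳ k))) (^-distribˡ-+-* 2 k k)

record Legendre (n : ℕ) : Set where
  field
    digitSum    : ℕ
    oddPart     : ℕ
    oddPart-odd : Odd oddPart
    factorial≡  : n ! * 2 ^ digitSum ≡ 2 ^ n * oddPart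
    digitSum≡0⇔ : digitSum ≡ 0 ⇔ n ≡ 0
    digitSum≡1⇔ : digitSum ≡ 1 ⇔ IsPowerOfTwo n

legendre-0 : Legendre 0
legendre-0 = record
  { digitSum = 0 ; oddPart = 1 ; oddPart-odd = odd-2k+1 0 ; factorial≡ = refl
  ; digitSum≡0⇔ = mk⇔ (λ _ → refl) (λ _ → refl)
  ; digitSum≡1⇔ = mk⇔ (λ ()) (λ pow2-0 → contradiction pow2-0 ¬pow2-0) }

legendre-double : ∀ k → Legendre k → Legendre (2 * k)
legendre-double k L = record
  { digitSum = digitSum ; oddPart = oddPart * oddFactorial k
  ; oddPart-odd = odd-* oddPart-odd (oddFactorial-odd k)
  ; factorial≡ = begin
      (2 * k) ! * 2 ^ digitSum                           ≡⟨ cong (_* 2 ^ digitSum) (double-factorial k) ⟩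
      2 ^ k * k ! * oddFactorial k * 2 ^ digitSum       ≡⟨ regroup₁ (2 ^ k) (k !) (oddFactorial k) (2 ^ digitSum) ⟩
      2 ^ k * (k ! * 2 ^ digitSum) * oddFactorial k     ≡⟨ cong (λ f → 2 ^ k * f * oddFactorial k) factorial≡ ⟩
      2 ^ k * (2 ^ k * oddPart) * oddFactorial k        ≡⟨ regroup₂ (2 ^ k) oddPart (oddFactorial k) ⟩
      2 ^ k * 2 ^ k * (oddPart * oddFactorial k)        ≡⟨ cong (_* (oddPart * oddFactorial k)) (sym (2^[2k] k)) ⟩
      2 ^ (2 * k) * (oddPart * oddFactorial k)          ∎
  ; digitSum≡0⇔ = mk⇔ (λ k≡0 → cong (2 *_) k≡0) (λ 2k≡0 → *-cancelˡ-≡ k 0 2 2k≡0) ⇔-∘ digitSum≡0⇔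
  ; digitSum≡1⇔ = ⇔-sym (pow2-double k) ⇔-∘ digitSum≡1⇔ }
  where
  open Legendre L
  regroup₁ : ∀ p f d t → p * f * d * t ≡ p * (f * t) * d
  regroup₁ = solve-∀
  regroup₂ : ∀ p o d → p * (p * o) * d ≡ p * p * (o * d)
  regroup₂ = solve-∀

legendre-double+1 : ∀ k → Legendre k → Legendre (suc (2 * k))
legendre-double+1 k L = record
  { digitSum = suc digitSum ; oddPart = suc (2 * k) * oddPart
  ; oddPart-odd = odd-* (odd-2k+1 k) oddPart-odd
  ; factorial≡ = begin
      suc (2 * k) * (2 * k) ! * (2 * 2 ^ digitSum)         ≡⟨ regroup₁ (suc (2 * k)) ((2 * k) !) (2 ^ digitSum) ⟩
      2 * (suc (2 * k) * ((2 * k) ! * 2 ^ digitSum))       ≡⟨ cong (λ f → 2 * (suc (2 * k) * f)) factorial≡ ⟩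
      2 * (suc (2 * k) * (2 ^ (2 * k) * oddPart))          ≡⟨ regroup₂ (suc (2 * k)) (2 ^ (2 * k)) oddPart ⟩
      2 * 2 ^ (2 * k) * (suc (2 * k) * oddPart)            ∎
  ; digitSum≡0⇔ = mk⇔ (λ ()) (λ ())
  ; digitSum≡1⇔ = ⇔-sym (pow2-odd k) ⇔-∘ (Legendre.digitSum≡0⇔ L ⇔-∘ mk⇔ suc-injective (cong suc)) }
  where
  open Legendre (legendre-double k L)
  regroup₁ : ∀ a f t → a * f * (2 * t) ≡ 2 * (a * (f * t))
  regroup₁ = solve-∀
  regroup₂ : ∀ a p o → 2 * (a * (p * o)) ≡ 2 * p * (a * o)
  regroup₂ = solve-∀

legendre : ∀ n → Legendre n
legendre = binary-induction Legendre legendre-0 legendre-double legendre-double+1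

-- If H · n! · X = 2^n · Y with X, Y odd and n > 0, then
-- comparing with Legendre's formula gives H · (odd) = 2^(s₂ n) · (odd), so
-- v₂(H) = s₂(n) ≥ 1: H is even, and H/2 is odd iff s₂(n) = 1, i.e. n is a power of two.
halving-criterion : ∀ n H X Y → n > 0 → Odd X → Odd Y → H * n ! * X ≡ 2 ^ n * Y
                  → OddQuotient 2 H (IsPowerOfTwo n)
halving-criterion n H X Y n>0 odd-X odd-Y H·n!·X≡ = by-exponent digitSum valuation digitSum≡0⇔ digitSum≡1⇔
  where
  open Legendre (legendre n)
  regroup₁ : ∀ h x o p → h * (x * o) * p ≡ h * x * (p * o)
  regroup₁ = solve-∀
  regroup₂ : ∀ h x f t → h * x * (f * t) ≡ h * f * x * t
  regroup₂ = solve-∀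
  regroup₃ : ∀ p y t → p * y * t ≡ t * y * p
  regroup₃ = solve-∀
  valuation : H * (X * oddPart) ≡ 2 ^ digitSum * Y
  valuation = *-cancelʳ-≡ _ _ (2 ^ n) {{m^n≢0 2 n}} (begin
    H * (X * oddPart) * 2 ^ n          ≡⟨ regroup₁ H X oddPart (2 ^ n) ⟩
    H * X * (2 ^ n * oddPart)          ≡⟨ cong (H * X *_) (sym factorial≡) ⟩
    H * X * (n ! * 2 ^ digitSum)       ≡⟨ regroup₂ H X (n !) (2 ^ digitSum) ⟩
    H * n ! * X * 2 ^ digitSum         ≡⟨ cong (_* 2 ^ digitSum) H·n!·X≡ ⟩
    2 ^ n * Y * 2 ^ digitSum           ≡⟨ regroup₃ (2 ^ n) Y (2 ^ digitSum) ⟩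
    2 ^ digitSum * Y * 2 ^ n           ∎)
  by-exponent : ∀ s → H * (X * oddPart) ≡ 2 ^ s * Y → (s ≡ 0 ⇔ n ≡ 0) → (s ≡ 1 ⇔ IsPowerOfTwo n)
              → OddQuotient 2 H (IsPowerOfTwo n)
  by-exponent zero _ s≡0⇔ _ = contradiction (Equivalence.to s≡0⇔ refl) (>⇒≢ n>0)
  by-exponent (suc s) v _ s≡1⇔ =
    oddQuotient-⇔ (s≡1⇔ ⇔-∘ mk⇔ (cong suc) suc-injective)
      (halving-by-exponent s v (odd-* odd-X oddPart-odd) odd-Y)

odd⇒nonZero : ∀ {x} → Odd x → NonZero x
odd⇒nonZero {zero}  odd-0 = contradiction (divides 0 refl) odd-0
odd⇒nonZero {suc x} _     = _

binomial-factorials : ∀ a b → ((a + b) C b) * (b ! * a !) ≡ (a + b) !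
binomial-factorials a b = begin
    ((a + b) C b) * (b ! * a !)   ≡⟨ cong (λ k → ((a + b) C b) * (b ! * k !)) (sym (m+n∸n≡m a b)) ⟩
    ((a + b) C b) * d             ≡⟨ cong (_* d) (nCk≡n!/k![n-k]! b≤a+b) ⟩
    (a + b) ! / d * d             ≡⟨ m/n*n≡m (k![n∸k]!∣n! b≤a+b) ⟩
    (a + b) !                     ∎
  where
  b≤a+b : b ≤ a + b
  b≤a+b = m≤n+m b a
  d : ℕ
  d = b ! * (a + b ∸ b) !
  instance
    d≢0 : NonZero d
    d≢0 = b !* (a + b ∸ b) !≢0

-- Binomial coefficients binom(m+n, n) are nonzero, as their product with n!·m! is (m+n)!.
binomial≢0 : ∀ m n → NonZero ((m + n) C n)
binomial≢0 m n = ≢-nonZero λ C≡0 →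
  ≢-nonZero⁻¹ ((m + n) !) {{(m + n) !≢0}} (trans (sym (binomial-factorials m n)) (cong (_* (n ! * m !)) C≡0))

binomial-absorption : ∀ a b → ((a + suc b) C suc b) * suc b ≡ ((a + suc b) C b) * suc a
binomial-absorption a b = *-cancelʳ-≡ _ _ (b ! * a !) {{b !* a !≢0}} (begin
    ((a + suc b) C suc b) * suc b * (b ! * a !)  ≡⟨ regroup₁ ((a + suc b) C suc b) (suc b) (b !) (a !) ⟩
    ((a + suc b) C suc b) * (suc b ! * a !)      ≡⟨ binomial-factorials a (suc b) ⟩
    (a + suc b) !                              ≡⟨ cong _! (+-suc a b) ⟩
    (suc a + b) !                              ≡⟨ sym (binomial-factorials (suc a) b) ⟩
    ((suc a + b) C b) * (b ! * suc a !)          ≡⟨ cong (λ k → (k C b) * (b ! * suc a !)) (sym (+-suc a b)) ⟩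
    ((a + suc b) C b) * (b ! * suc a !)          ≡⟨ regroup₂ ((a + suc b) C b) (suc a) (b !) (a !) ⟩
    ((a + suc b) C b) * suc a * (b ! * a !)      ∎)
  where
  regroup₁ : ∀ c s f g → c * s * (f * g) ≡ c * (s * f * g)
  regroup₁ = solve-∀
  regroup₂ : ∀ c s f g → c * (f * (s * g)) ≡ c * s * (f * g)
  regroup₂ = solve-∀

central-binomial-factorials : ∀ n → ((2 * n) C n) * (n ! * n !) ≡ (2 * n) !
central-binomial-factorials n =
  subst (λ k → (k C n) * (n ! * n !) ≡ k !) (cong (n +_) (sym (+-identityʳ n))) (binomial-factorials n n)

central-binomial : ∀ n → ((2 * n) C n) * n ! ≡ 2 ^ n * oddFactorial n
central-binomial n = *-cancelʳ-≡ _ _ (n !) {{n !≢0}} (begin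
    ((2 * n) C n) * n ! * n !           ≡⟨ *-assoc ((2 * n) C n) (n !) (n !) ⟩
    ((2 * n) C n) * (n ! * n !)         ≡⟨ central-binomial-factorials n ⟩
    (2 * n) !                         ≡⟨ double-factorial n ⟩
    2 ^ n * n ! * oddFactorial n      ≡⟨ regroup (2 ^ n) (n !) (oddFactorial n) ⟩
    2 ^ n * oddFactorial n * n !      ∎)
  where
  regroup : ∀ p f d → p * f * d ≡ p * d * f
  regroup = solve-∀

-- The ratio G(m,n) = 2^n·(2m+1)(2m+3)⋯(2m+2n−1)/n! = 4^n·binom(m+n−½, n).
-- Pascal's rule for binom(·, n) gives the recursion below, which shows G(m,n) ∈ ℕ;
-- halfBinomial-spec identifies it with the ratio.
halfBinomial : ℕ → ℕ → ℕ
halfBinomial zero    n       = (2 * n) C n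
halfBinomial (suc m) zero    = 1
halfBinomial (suc m) (suc n) = halfBinomial m (suc n) + 4 * halfBinomial (suc m) n

halfBinomial-spec : ∀ m n → halfBinomial m n * n ! * oddFactorial m ≡ 2 ^ n * oddFactorial (m + n)
halfBinomial-spec zero    n       = trans (*-identityʳ _) (central-binomial n)
halfBinomial-spec (suc m) zero    = cong (λ k → 1 * oddFactorial k) (sym (+-identityʳ (suc m)))
halfBinomial-spec (suc m) (suc n) = begin
    (G₁ + 4 * G₂) * (suc n * n !) * (oddFactorial m * suc (2 * m))
      ≡⟨ regroup₁ G₁ G₂ n (n !) (oddFactorial m) m ⟩
    suc (2 * m) * (G₁ * suc n ! * oddFactorial m) + 4 * suc n * (G₂ * n ! * oddFactorial (suc m))
      ≡⟨ cong₂ (λ x y → suc (2 * m) * x + 4 * suc n * y) (halfBinomial-spec m (suc n))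
           (trans (halfBinomial-spec (suc m) n) (cong (λ k → 2 ^ n * oddFactorial k) (sym (+-suc m n)))) ⟩
    suc (2 * m) * (2 ^ suc n * oddFactorial (m + suc n)) + 4 * suc n * (2 ^ n * oddFactorial (m + suc n))
      ≡⟨ regroup₂ m n (2 ^ n) (oddFactorial (m + suc n)) ⟩
    2 ^ suc n * oddFactorial (suc m + suc n) ∎
  where
  G₁ : ℕ
  G₁ = halfBinomial m (suc n)
  G₂ : ℕ
  G₂ = halfBinomial (suc m) n
  regroup₁ : ∀ g₁ g₂ n f d m → (g₁ + 4 * g₂) * ((1 + n) * f) * (d * (1 + 2 * m))
           ≡ (1 + 2 * m) * (g₁ * ((1 + n) * f) * d) + 4 * (1 + n) * (g₂ * f * (d * (1 + 2 * m)))
  regroup₁ = solve-∀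
  regroup₂ : ∀ m n p d → (1 + 2 * m) * (2 * p * d) + 4 * (1 + n) * (p * d)
           ≡ 2 * p * (d * (1 + 2 * (m + (1 + n))))
  regroup₂ = solve-∀

halfBinomial-shift : ∀ m n → suc n * halfBinomial m (suc n) ≡ 2 * suc (2 * m) * halfBinomial (suc m) n
halfBinomial-shift m n = *-cancelʳ-≡ _ _ (n ! * oddFactorial m) {{n!·oddFactorial≢0}} (begin
    suc n * G₁ * (n ! * oddFactorial m)               ≡⟨ regroup₁ (suc n) G₁ (n !) (oddFactorial m) ⟩
    G₁ * suc n ! * oddFactorial m                     ≡⟨ halfBinomial-spec m (suc n) ⟩
    2 * 2 ^ n * oddFactorial (m + suc n)              ≡⟨ cong (λ k → 2 * 2 ^ n * oddFactorial k) (+-suc m n) ⟩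
    2 * 2 ^ n * oddFactorial (suc m + n)              ≡⟨ *-assoc 2 (2 ^ n) (oddFactorial (suc m + n)) ⟩
    2 * (2 ^ n * oddFactorial (suc m + n))            ≡⟨ cong (2 *_) (sym (halfBinomial-spec (suc m) n)) ⟩
    2 * (G₂ * n ! * (oddFactorial m * suc (2 * m)))   ≡⟨ regroup₂ (suc (2 * m)) G₂ (n !) (oddFactorial m) ⟩
    2 * suc (2 * m) * G₂ * (n ! * oddFactorial m)     ∎)
  where
  G₁ : ℕ
  G₁ = halfBinomial m (suc n)
  G₂ : ℕ
  G₂ = halfBinomial (suc m) n
  n!·oddFactorial≢0 : NonZero (n ! * oddFactorial m)
  n!·oddFactorial≢0 = m*n≢0 (n !) (oddFactorial m) {{n !≢0}} {{odd⇒nonZero (oddFactorial-odd m)}}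
  regroup₁ : ∀ s g f d → s * g * (f * d) ≡ g * (s * f) * d
  regroup₁ = solve-∀
  regroup₂ : ∀ s g f d → 2 * (g * f * (d * s)) ≡ 2 * s * g * (f * d)
  regroup₂ = solve-∀

-- binom(2n,n) · binom(2m+2n,2n) = G(m,n) · binom(m+n,n): both sides times n!·n!·(2m)!
-- equal (2m+2n)!.
central-product : ∀ m n → ((2 * n) C n) * ((2 * m + 2 * n) C (2 * n)) ≡ halfBinomial m n * ((m + n) C n)
central-product m n = *-cancelʳ-≡ _ _ (n ! * n ! * (2 * m) !) {{m*n≢0 _ _ {{n !* n !≢0}} {{(2 * m) !≢0}}}} (begin
    c * b * (n ! * n ! * (2 * m) !)                 ≡⟨ regroup₁ c b (n !) ((2 * m) !) ⟩
    b * (c * (n ! * n !) * (2 * m) !)               ≡⟨ cong (λ f → b * (f * (2 * m) !)) (central-binomial-factorials n) ⟩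
    b * ((2 * n) ! * (2 * m) !)                     ≡⟨ binomial-factorials (2 * m) (2 * n) ⟩
    (2 * m + 2 * n) !                               ≡⟨ cong _! (sym (*-distribˡ-+ 2 m n)) ⟩
    (2 * (m + n)) !                                 ≡⟨ double-factorial (m + n) ⟩
    2 ^ (m + n) * (m + n) ! * oddFactorial (m + n)  ≡⟨ cong (λ p → p * (m + n) ! * oddFactorial (m + n)) (^-distribˡ-+-* 2 m n) ⟩
    2 ^ m * 2 ^ n * (m + n) ! * oddFactorial (m + n) ≡⟨ regroup₂ (2 ^ m) (2 ^ n) ((m + n) !) (oddFactorial (m + n)) ⟩
    2 ^ m * (m + n) ! * (2 ^ n * oddFactorial (m + n))
      ≡⟨ cong₂ (λ x y → 2 ^ m * x * y) (sym (binomial-factorials m n)) (sym (halfBinomial-spec m n)) ⟩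
    2 ^ m * (B * (n ! * m !)) * (G * n ! * oddFactorial m) ≡⟨ regroup₃ (2 ^ m) B G (n !) (m !) (oddFactorial m) ⟩
    G * B * (n ! * n ! * (2 ^ m * m ! * oddFactorial m))   ≡⟨ cong (λ f → G * B * (n ! * n ! * f)) (sym (double-factorial m)) ⟩
    G * B * (n ! * n ! * (2 * m) !)                 ∎)
  where
  c : ℕ
  c = (2 * n) C n
  b : ℕ
  b = (2 * m + 2 * n) C (2 * n)
  B : ℕ
  B = (m + n) C n
  G : ℕ
  G = halfBinomial m n
  regroup₁ : ∀ c b f e → c * b * (f * f * e) ≡ b * (c * (f * f) * e)
  regroup₁ = solve-∀
  regroup₂ : ∀ p q f d → p * q * f * d ≡ p * f * (q * d)
  regroup₂ = solve-∀
  regroup₃ : ∀ p B G f g d → p * (B * (f * g)) * (G * f * d) ≡ G * B * (f * f * (p * g * d))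
  regroup₃ = solve-∀

-- binom(2n,n) · binom(2m+2n,2n−1) = G(m+1,n−1) · 4 · binom(m+n,n), for n = N+1:
-- multiply by 2m+1, absorb, and use the shift relation.
central-product-pred : ∀ m N → ((2 * suc N) C suc N) * ((2 * m + 2 * suc N) C (2 * suc N ∸ 1))
                     ≡ halfBinomial (suc m) N * 4 * ((m + suc N) C suc N)
central-product-pred m N = *-cancelʳ-≡ _ _ (suc (2 * m)) (begin
    c * b′ * suc (2 * m)                       ≡⟨ *-assoc c b′ (suc (2 * m)) ⟩
    c * (b′ * suc (2 * m))                     ≡⟨ cong (c *_) absorbed ⟩
    c * (b * (2 * n))                          ≡⟨ sym (*-assoc c b (2 * n)) ⟩
    c * b * (2 * n)                            ≡⟨ cong (_* (2 * n)) (central-product m n) ⟩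
    halfBinomial m n * B * (2 * n)             ≡⟨ regroup₁ (halfBinomial m n) B n ⟩
    2 * (n * halfBinomial m n) * B             ≡⟨ cong (λ g → 2 * g * B) (halfBinomial-shift m N) ⟩
    2 * (2 * suc (2 * m) * G′) * B             ≡⟨ regroup₂ (suc (2 * m)) G′ B ⟩
    G′ * 4 * B * suc (2 * m)                   ∎)
  where
  n : ℕ
  n = suc N
  c : ℕ
  c = (2 * n) C n
  b : ℕ
  b = (2 * m + 2 * n) C (2 * n)
  b′ : ℕ
  b′ = (2 * m + 2 * n) C (2 * n ∸ 1)
  B : ℕ
  B = (m + n) C n
  G′ : ℕ
  G′ = halfBinomial (suc m) N
  absorbed : b′ * suc (2 * m) ≡ b * (2 * n)
  absorbed = subst (λ t → ((2 * m + t) C (t ∸ 1)) * suc (2 * m) ≡ ((2 * m + t) C t) * t)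
                   (sym (*-suc 2 N)) (sym (binomial-absorption (2 * m) (suc (2 * N))))
  regroup₁ : ∀ g B n → g * B * (2 * n) ≡ 2 * (n * g) * B
  regroup₁ = solve-∀
  regroup₂ : ∀ s g B → 2 * (2 * s * g) * B ≡ g * 4 * B * s
  regroup₂ = solve-∀

-- Generalized Catalan numbers: (hM+1) · C^{(h)}_M = binom((h+1)M, M) for M ≥ 1,
-- by absorption  binom((h+1)M, M) · M = binom((h+1)M, M−1) · (hM+1).
catalan-spec : ∀ h M → catalan h (suc M) * suc (h * suc M) ≡ (suc h * suc M) C suc M
catalan-spec h M = begin
    (X ∸ h * Y) * suc R          ≡⟨ *-distribʳ-∸ (suc R) X (h * Y) ⟩
    X * suc R ∸ h * Y * suc R    ≡⟨ cong (X * suc R ∸_) hY≡XR ⟩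
    X * suc R ∸ X * R            ≡⟨ cong (_∸ X * R) (*-suc X R) ⟩
    X + X * R ∸ X * R            ≡⟨ m+n∸n≡m X (X * R) ⟩
    X                            ∎
  where
  r : ℕ
  r = suc M
  R : ℕ
  R = h * r
  X : ℕ
  X = (suc h * r) C r
  Y : ℕ
  Y = (suc h * r) C M
  absorbed : X * r ≡ Y * suc R
  absorbed = subst (λ k → (k C r) * r ≡ (k C M) * suc R) (+-comm R r) (binomial-absorption R M)
  hY≡XR : h * Y * suc R ≡ X * R
  hY≡XR = begin
    h * Y * suc R    ≡⟨ *-assoc h Y (suc R) ⟩
    h * (Y * suc R)  ≡⟨ cong (h *_) (sym absorbed) ⟩
    h * (X * r)      ≡⟨ x∙yz≈y∙xz h X r ⟩
    X * (h * r)      ∎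

coprime-1+an : ∀ a n → Coprime (suc (a * n)) n
coprime-1+an a n {d} (d∣1+an , d∣n) =
  ∣1⇒≡1 (∣m+n∣m⇒∣n (subst (d ∣_) (+-comm 1 (a * n)) d∣1+an) (∣n⇒∣m*n a d∣n))

catalan-product : ∀ h N → let n = suc N ; m = h * n in
  ((2 * n) C n) * catalan h (2 * n) * suc (2 * m) ≡ ((2 * n) C n) * ((2 * m + 2 * n) C (2 * n))
catalan-product h N = begin
    c * catalan h (2 * n) * suc (2 * m)        ≡⟨ *-assoc c (catalan h (2 * n)) (suc (2 * m)) ⟩
    c * (catalan h (2 * n) * suc (2 * m))      ≡⟨ cong (λ k → c * (catalan h (2 * n) * suc k)) (sym (hn-swap h n)) ⟩
    c * (catalan h (2 * n) * suc (h * (2 * n))) ≡⟨ cong (c *_) (catalan-spec h (N + (n + 0))) ⟩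
    c * ((suc h * (2 * n)) C (2 * n))          ≡⟨ cong (λ k → c * (k C (2 * n))) (sum h n) ⟩
    c * ((2 * m + 2 * n) C (2 * n))            ∎
  where
  n : ℕ
  n = suc N
  m : ℕ
  m = h * n
  c : ℕ
  c = (2 * n) C n
  hn-swap : ∀ h n → h * (2 * n) ≡ 2 * (h * n)
  hn-swap = solve-∀
  sum : ∀ h n → suc h * (2 * n) ≡ 2 * (h * n) + 2 * n
  sum = solve-∀

-- When 2m+1 is coprime to n, the shift relation  n·G(m,n) = 2(2m+1)·G(m+1,n−1)
-- forces 2m+1 ∣ G(m,n).
halfBinomial-divisible : ∀ m N → Coprime (suc (2 * m)) (suc N) → suc (2 * m) ∣ halfBinomial m (suc N)
halfBinomial-divisible m N coprime =
  coprime-divisor coprime (divides (2 * G′) (trans (halfBinomial-shift m N) (regroup (suc (2 * m)) G′)))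
  where
  G′ : ℕ
  G′ = halfBinomial (suc m) N
  regroup : ∀ s g → 2 * s * g ≡ 2 * g * s
  regroup = solve-∀

-- Part (ii) in general form: if X · (2m+1) = binom(2n,n)·binom(2m+2n,2n) and 2m+1 is
-- coprime to n, then X = H · binom(m+n,n) with H = G(m,n)/(2m+1), and the halving
-- criterion applies to H with the odd factors (2m+1)!! and (2m+2n−1)!!.
oddQuotient-coprime : ∀ m N X → let n = suc N in
  X * suc (2 * m) ≡ ((2 * n) C n) * ((2 * m + 2 * n) C (2 * n)) → Coprime (suc (2 * m)) n →
  OddQuotient (2 * ((m + n) C n)) X (IsPowerOfTwo n)
oddQuotient-coprime m N X X·[2m+1]≡ coprime with halfBinomial-divisible m N coprime
... | divides H G≡H·[2m+1] =
  subst (λ Y → OddQuotient (2 * B) Y (IsPowerOfTwo n)) (sym X≡H·B)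
    (oddQuotient-scale B {{binomial≢0 m n}}
      (halving-criterion n H (oddFactorial (suc m)) (oddFactorial (m + n)) z<s
        (oddFactorial-odd (suc m)) (oddFactorial-odd (m + n)) H-spec))
  where
  n : ℕ
  n = suc N
  B : ℕ
  B = (m + n) C n
  s : ℕ
  s = suc (2 * m)
  X≡H·B : X ≡ H * B
  X≡H·B = *-cancelʳ-≡ X (H * B) s (begin
    X * s                                       ≡⟨ X·[2m+1]≡ ⟩
    ((2 * n) C n) * ((2 * m + 2 * n) C (2 * n)) ≡⟨ central-product m n ⟩
    halfBinomial m n * B                        ≡⟨ cong (_* B) G≡H·[2m+1] ⟩
    H * s * B                                   ≡⟨ regroup H s B ⟩
    H * B * s                                   ∎)
    where
    regroup : ∀ h s b → h * s * b ≡ h * b * s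
    regroup = solve-∀
  H-spec : H * n ! * oddFactorial (suc m) ≡ 2 ^ n * oddFactorial (m + n)
  H-spec = begin
    H * n ! * (oddFactorial m * s)      ≡⟨ regroup H (n !) (oddFactorial m) s ⟩
    H * s * n ! * oddFactorial m        ≡⟨ cong (λ g → g * n ! * oddFactorial m) (sym G≡H·[2m+1]) ⟩
    halfBinomial m n * n ! * oddFactorial m ≡⟨ halfBinomial-spec m n ⟩
    2 ^ n * oddFactorial (m + n)        ∎
    where
    regroup : ∀ h f d s → h * f * (d * s) ≡ h * s * f * d
    regroup = solve-∀

claim-i-central : ∀ m n → n > 0 →
  OddQuotient (2 * ((m + n) C n)) (((2 * n) C n) * ((2 * m + 2 * n) C (2 * n))) (IsPowerOfTwo n)
claim-i-central m n n>0 =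
  subst (λ Y → OddQuotient (2 * ((m + n) C n)) Y (IsPowerOfTwo n)) (sym (central-product m n))
    (oddQuotient-scale ((m + n) C n) {{binomial≢0 m n}}
      (halving-criterion n (halfBinomial m n) (oddFactorial m) (oddFactorial (m + n)) n>0
        (oddFactorial-odd m) (oddFactorial-odd (m + n)) (halfBinomial-spec m n)))

claim-i-pred : ∀ m N → N > 0 →
  OddQuotient (8 * ((m + suc N) C suc N)) (((2 * suc N) C suc N) * ((2 * m + 2 * suc N) C (2 * suc N ∸ 1)))
              (IsPowerOfTwo N)
claim-i-pred m N N>0 =
  subst (λ Y → OddQuotient (8 * ((m + suc N) C suc N)) Y (IsPowerOfTwo N)) (sym (central-product-pred m N))
    (oddQuotient-scale ((m + suc N) C suc N) {{binomial≢0 m (suc N)}} (oddQuotient-scale 4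
      (halving-criterion N (halfBinomial (suc m) N) (oddFactorial (suc m)) (oddFactorial (suc m + N)) N>0
        (oddFactorial-odd (suc m)) (oddFactorial-odd (suc m + N)) (halfBinomial-spec (suc m) N))))

claim-ii : ∀ h N → let n = suc N in
  OddQuotient (2 * ((suc h * n) C n)) (((2 * n) C n) * catalan h (2 * n)) (IsPowerOfTwo n)
claim-ii h N =
  subst (λ k → OddQuotient (2 * (k C n)) (((2 * n) C n) * catalan h (2 * n)) (IsPowerOfTwo n)) (+-comm (h * n) n)
    (oddQuotient-coprime (h * n) N (((2 * n) C n) * catalan h (2 * n)) (catalan-product h N)
      (subst (λ k → Coprime (suc k) n) (*-assoc 2 h n) (coprime-1+an (2 * h) n)))
  where
  n : ℕ
  n = suc N

theorem1p1 :
    ((m n : ℕ) → n > 0 →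
      ((2 * ((m + n) C n)) ∣ (((2 * n) C n) * ((2 * m + 2 * n) C (2 * n)))
        × (∀ q → 2 * ((m + n) C n) * q ≡ ((2 * n) C n) * ((2 * m + 2 * n) C (2 * n))
             → (Odd q ⇔ IsPowerOfTwo n)))
      × (n > 1 →
          ((8 * ((m + n) C n)) ∣ (((2 * n) C n) * ((2 * m + 2 * n) C (2 * n ∸ 1)))
            × (∀ q → 8 * ((m + n) C n) * q ≡ ((2 * n) C n) * ((2 * m + 2 * n) C (2 * n ∸ 1))
                 → (Odd q ⇔ IsPowerOfTwo (n ∸ 1))))))
    × ((k n : ℕ) → k > 0 → n > 0 →
      ((2 * ((k * n) C n)) ∣ (((2 * n) C n) * catalan (k ∸ 1) (2 * n)))
        × (∀ q → 2 * ((k * n) C n) * q ≡ ((2 * n) C n) * catalan (k ∸ 1) (2 * n)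
             → (Odd q ⇔ IsPowerOfTwo n)))
theorem1p1 =
    (λ { m (suc N) n>0 → claim-i-central m (suc N) n>0 , λ { (s≤s N>0) → claim-i-pred m N N>0 } })
  , (λ { (suc h) (suc N) _ _ → claim-ii h N })
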